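{- Let $1 \le j \le n-1$. Define $$F = \begin{cases} \bigcup_{h \in H_j^+} \{(h, h') : (h, h') \in K_{j+1}\} & \text{if } j \geq s, \\ \bigcup_{h \in H_j^+} \{(h, h') : (h, h') \in K_{j+1}\} \cup \{\pi_{j+1}^n(p_{j+1}), -\pi_{j+1}^n(p_{j+1})\} & \text{if } j < s. \end{cases}$$ Then $F$ generates $K_{j+1}^+ \cup K_{j+1}^-$ over $\mathbb{Z}_+$, that is, every $z \in K_{j+1}^+ \cup K_{j+1}^-$ can be written as a non-negative integer linear combination of (finitely many) elements of $F$.
   Context: Let $1 \le s \le n$ and let $p_1,\dots,p_s \in \mathbb{Z}^n$ be such that $p_i$ has its first $i-1$ coordinates equal to $0$ and its $i$-th coordinate $p_{i,i} > 0$ ($i=1,\dots,s$). Let $\Lambda \subseteq \mathbb{Z}^n$ be the lattice generated by $p_1,\dots,p_s$ over $\mathbb{Z}$. For $m \ge j$ let $\pi_j^m : \mathbb{R}^m \to \mathbb{R}^j$ be the projection onto the first $j$ coordinates. Let $K_j := \{\pi_j^n(v) : v \in \Lambda\} \subseteq \mathbb{Z}^j$, $K_j^+ := K_j \cap (\mathbb{R}_+^{j-1} \times \mathbb{R}_+)$ and $K_j^- := K_j \cap (\mathbb{R}_+^{j-1} \times \mathbb{R}_-)$, where $\mathbb{R}_+=[0,\infty)$, $\mathbb{R}_-=(-\infty,0]$. $(K_j^+,+)$ and $(K_j^-,+)$ are monoids; $H_j^+$ and $H_j^-$ denote their unique inclusion-minimal generating sets (generating over the non-negative integers). Vectors in $\mathbb{R}^{j+1}$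 are written $(h,h')$ with $h \in \mathbb{R}^j$, $h' \in \mathbb{R}$. -}

module Defs where

open import Data.Nat as ℕ using (ℕ; zero; suc; _≤_; _<_)
open import Data.Integer as ℤ using (ℤ; +_; 0ℤ)
open import Data.Fin using (Fin; toℕ; inject≤; fromℕ<)
open import Data.Vec using (Vec; []; _∷_; lookup; tabulate; zipWith; map; replicate; init; last)
open import Data.Vec.Relation.Unary.All using (All)
open import Data.List using (List)
import Data.List as L
open import Data.List.Relation.Unary.All as LA using ()
open import Data.Product using (Σ; ∃; _×_; _,_; proj₁; proj₂)
open import Data.Sum using (_⊎_)
open import Relation.Binary.PropositionalEquality using (_≡_)

ZVec : ℕ → Set
ZVec m = Vec ℤ m

ZSet : ℕ → Set₁
ZSet m = ZVec m → Set

_⊆_ : ∀ {m} → ZSet m → ZSet m → Set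
A ⊆ B = ∀ v → A v → B v

_∪_ : ∀ {m} → ZSet m → ZSet m → ZSet m
(A ∪ B) v = A v ⊎ B v

0v : ∀ {m} → ZVec m
0v = replicate _ 0ℤ

_+v_ : ∀ {m} → ZVec m → ZVec m → ZVec m
_+v_ = zipWith ℤ._+_

_·v_ : ∀ {m} → ℤ → ZVec m → ZVec m
c ·v v = map (c ℤ.*_) v

-v_ : ∀ {m} → ZVec m → ZVec m
-v v = map ℤ.-_ v

zComb : ∀ {s m} → Vec ℤ s → Vec (ZVec m) s → ZVec m
zComb [] [] = 0v
zComb (c ∷ cs) (p ∷ ps) = (c ·v p) +v zComb cs ps

ℕComb : ∀ {m} → List (ℕ × ZVec m) → ZVec m
ℕComb = L.foldr (λ cv acc → ((+ proj₁ cv) ·v proj₂ cv) +v acc) 0v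

InMonoidSpan : ∀ {m} → ZSet m → ZVec m → Set
InMonoidSpan F z = Σ (List (ℕ × ZVec _)) λ l →
  LA.All (λ cv → F (proj₂ cv)) l × ℕComb l ≡ z

Generates : ∀ {m} → ZSet m → ZSet m → Set
Generates G M = G ⊆ M × M ⊆ InMonoidSpan G

IsMinimalGenSet : ∀ {m} → ZSet m → ZSet m → Set₁
IsMinimalGenSet H M =
  Generates H M × (∀ (H' : ZSet _) → H' ⊆ H → Generates H' M → H ⊆ H')

π : ∀ {n} j → j ≤ n → ZVec n → ZVec j
π j j≤n v = tabulate (λ k → lookup v (inject≤ k j≤n))

-- hypotheses on p_1,…,p_s (0-indexed: p i for i : Fin s)
-- p_i has its first i coordinates zero and its i-th coordinate positive
Echelon : ∀ {n s} → Vec (ZVec n) s → Set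
Echelon {n} {s} p =
  (∀ (i : Fin s) (k : Fin n) → toℕ k < toℕ i → lookup (lookup p i) k ≡ 0ℤ) ×
  (∀ (i : Fin s) (k : Fin n) → toℕ k ≡ toℕ i → 0ℤ ℤ.< lookup (lookup p i) k)

Λ : ∀ {n s} → Vec (ZVec n) s → ZSet n
Λ {s = s} p v = Σ (Vec ℤ s) λ c → zComb c p ≡ v

K : ∀ {n s} → Vec (ZVec n) s → ∀ j → j ≤ n → ZSet j
K p j j≤n w = Σ (ZVec _) λ v → Λ p v × π j j≤n v ≡ w

NonNegAll : ∀ {m} → ZSet m
NonNegAll v = All (0ℤ ℤ.≤_) v

NonNegLastNonPos : ∀ {m} → ZSet (suc m)
NonNegLastNonPos v = All (0ℤ ℤ.≤_) (init v) × last v ℤ.≤ 0ℤ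

K⁺ : ∀ {n s} → Vec (ZVec n) s → ∀ j → j ≤ n → ZSet j
K⁺ p j j≤n w = K p j j≤n w × NonNegAll w

K⁻ : ∀ {n s} → Vec (ZVec n) s → ∀ j → suc j ≤ n → ZSet (suc j)
K⁻ p j le w = K p (suc j) le w × NonNegLastNonPos w

-- the set F of the lemma, for 1 ≤ j ≤ n-1, given H = H_j^+
-- (h , h') ∈ ℤ^{j+1} corresponds to z with init z = h, last z = h'
Fset : ∀ {n s} → Vec (ZVec n) s → ∀ j → (le : suc j ≤ n) → ZSet j → ZSet (suc j)
Fset {s = s} p j le H z =
  (H (init z) × K p (suc j) le z) ⊎
  (Σ (j < s) λ j<s →
     (z ≡ π (suc j) le (lookup p (fromℕ< j<s))) ⊎
     (z ≡ -v π (suc j) le (lookup p (fromℕ< j<s))))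

{-# OPTIONS --safe #-}

-- Write z = π_{j+1} v with v ∈ Λ. Its first j coordinates π_j v are non-negative,
-- hence a ℤ₊-combination of H; lifting every h ∈ H to a point (h , h') ∈ K_{j+1},
-- which lies in F, turns it into a point π_{j+1} u of the ℤ₊-span of F with u ∈ Λ
-- and π_j u = π_j v. As the p_i are in echelon form, a lattice vector whose first
-- j coordinates vanish has zero coefficients on p_1, …, p_j, so its first j + 1
-- coordinates are t · π_{j+1}(p_{j+1}) for some t ∈ ℤ, or 0 when j ≥ s. Hence
-- z − π_{j+1} u is such a multiple, and F contains both ±π_{j+1}(p_{j+1}), so the
-- sign of the last coordinate of z never matters.

module Submission where

open import Defs
open import Data.Nat using (ℕ; suc; _≤_; _<_)
open import Data.Vec using (Vec)
open import Data.Nat.Properties using (≤-trans; n≤1+n)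

open import Data.Empty using (⊥-elim)
open import Data.Fin using (Fin; zero; suc; toℕ; inject≤; inject₁; fromℕ<)
open import Data.Fin.Properties
  using (toℕ-injective; toℕ-inject≤; toℕ-inject₁; toℕ<n; toℕ-fromℕ<; suc-injective)
open import Data.Integer as ℤ using (ℤ; +_; -[1+_]; 0ℤ; -1ℤ; _+_; _*_; -_)
import Data.Integer.Properties as ℤₚ
open import Data.Integer.Tactic.RingSolver using (solve-∀)
open import Data.List using (List; []; _∷_; _++_)
open import Data.List.Relation.Unary.All using (All; []; _∷_)
open import Data.List.Relation.Unary.All.Properties using (++⁺)
open import Data.Nat using (s≤s⁻¹; _<?_)
import Data.Nat.Properties as ℕₚ
open import Data.Product using (Σ; _×_; _,_; proj₁; proj₂)
open import Data.Sum using (_⊎_; inj₁; inj₂; [_,_]′)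
open import Data.Vec using ([]; _∷_; lookup; init; replicate)
open import Data.Vec.Properties
  using (lookup-zipWith; lookup-map; lookup-replicate; lookup∘tabulate; map-∘; map-cong;
         zipWith-identityˡ; zipWith-identityʳ; zipWith-assoc)
open import Data.Vec.Relation.Binary.Pointwise.Extensional using (ext; Pointwise-≡⇒≡)
import Data.Vec.Relation.Unary.All as VecAll
open import Function using (_∘_)
open import Relation.Binary.Definitions using (tri<; tri≈; tri>)
open import Relation.Binary.PropositionalEquality
open import Relation.Nullary using (Dec; yes; no)
open ≡-Reasoning

private variable
  m n s j : ℕ

≡-by-lookup : {A : Set} {u v : Vec A m} → (∀ i → lookup u i ≡ lookup v i) → u ≡ v
≡-by-lookup u≗v = Pointwise-≡⇒≡ (ext u≗v)

lookup-+v : (u v : ZVec m) (i : Fin m) → lookup (u +v v) i ≡ lookup u i + lookup v i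
lookup-+v u v i = lookup-zipWith _+_ i u v

lookup-·v : (c : ℤ) (v : ZVec m) (i : Fin m) → lookup (c ·v v) i ≡ c * lookup v i
lookup-·v c v i = lookup-map i (c *_) v

lookup-0v : (i : Fin m) → lookup 0v i ≡ 0ℤ
lookup-0v i = lookup-replicate i 0ℤ

lookup-π : (le : j ≤ n) (v : ZVec n) (k : Fin j) →
  lookup (π j le v) k ≡ lookup v (inject≤ k le)
lookup-π _ v k = lookup∘tabulate _ k

lookup-init : {A : Set} (v : Vec A (suc m)) (k : Fin m) →
  lookup (init v) k ≡ lookup v (inject₁ k)
lookup-init (x ∷ v) zero    = refl
lookup-init (x ∷ v) (suc k) = lookup-init v k

All-init : {A : Set} {P : A → Set} {v : Vec A (suc m)} →
  VecAll.All P v → VecAll.All P (init v)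
All-init {m = 0}     {v = _ ∷ []} (px VecAll.∷ VecAll.[]) = VecAll.[]
All-init {m = suc m} {v = _ ∷ v}  (px VecAll.∷ pv)        = px VecAll.∷ All-init pv

+v-identityˡ : (v : ZVec m) → 0v +v v ≡ v
+v-identityˡ = zipWith-identityˡ ℤₚ.+-identityˡ

+v-identityʳ : (v : ZVec m) → v +v 0v ≡ v
+v-identityʳ = zipWith-identityʳ ℤₚ.+-identityʳ

+v-assoc : (u v w : ZVec m) → (u +v v) +v w ≡ u +v (v +v w)
+v-assoc = zipWith-assoc ℤₚ.+-assoc

+v-inverseʳ : (v : ZVec m) → v +v (-1ℤ ·v v) ≡ 0v
+v-inverseʳ []      = refl
+v-inverseʳ (x ∷ v) = cong₂ _∷_ (inverse x) (+v-inverseʳ v)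
  where
  inverse : ∀ x → x + -1ℤ * x ≡ 0ℤ
  inverse = solve-∀

+v-cancel : (u v : ZVec m) → u +v (v +v (-1ℤ ·v u)) ≡ v
+v-cancel []      []      = refl
+v-cancel (x ∷ u) (y ∷ v) = cong₂ _∷_ (cancel x y) (+v-cancel u v)
  where
  cancel : ∀ x y → x + (y + -1ℤ * x) ≡ y
  cancel = solve-∀

·v-neg : (c : ℤ) (v : ZVec m) → c ·v (-v v) ≡ (- c) ·v v
·v-neg c v = trans (sym (map-∘ (c *_) -_ v)) (map-cong neg v)
  where
  neg : ∀ x → c * - x ≡ - c * x
  neg x = trans (sym (ℤₚ.neg-distribʳ-* c x)) (ℤₚ.neg-distribˡ-* c x)

π-0v : (le : j ≤ n) → π j le 0v ≡ 0v
π-0v {j = j} {n = n} le = ≡-by-lookup λ k → begin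
  lookup (π j le 0v) k           ≡⟨ lookup-π le 0v k ⟩
  lookup (0v {n}) (inject≤ k le) ≡⟨ lookup-0v (inject≤ k le) ⟩
  0ℤ                             ≡⟨ lookup-0v k ⟨
  lookup 0v k                    ∎

π-+v : (le : j ≤ n) (u v : ZVec n) → π j le (u +v v) ≡ π j le u +v π j le v
π-+v {j = j} le u v = ≡-by-lookup λ k → begin
  lookup (π j le (u +v v)) k
    ≡⟨ lookup-π le (u +v v) k ⟩
  lookup (u +v v) (inject≤ k le)
    ≡⟨ lookup-+v u v (inject≤ k le) ⟩
  lookup u (inject≤ k le) + lookup v (inject≤ k le)
    ≡⟨ cong₂ _+_ (lookup-π le u k) (lookup-π le v k) ⟨
  lookup (π j le u) k + lookup (π j le v) k
    ≡⟨ lookup-+v (π j le u) (π j le v) k ⟨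
  lookup (π j le u +v π j le v) k
    ∎

π-·v : (le : j ≤ n) (c : ℤ) (v : ZVec n) → π j le (c ·v v) ≡ c ·v π j le v
π-·v {j = j} le c v = ≡-by-lookup λ k → begin
  lookup (π j le (c ·v v)) k     ≡⟨ lookup-π le (c ·v v) k ⟩
  lookup (c ·v v) (inject≤ k le) ≡⟨ lookup-·v c v (inject≤ k le) ⟩
  c * lookup v (inject≤ k le)    ≡⟨ cong (c *_) (lookup-π le v k) ⟨
  c * lookup (π j le v) k        ≡⟨ lookup-·v c (π j le v) k ⟨
  lookup (c ·v π j le v) k       ∎

init-π : (le : suc j ≤ n) (le' : j ≤ n) (v : ZVec n) → init (π (suc j) le v) ≡ π j le' v
init-π {j = j} le le' v = ≡-by-lookup λ k → begin
  lookup (init (π (suc j) le v)) k     ≡⟨ lookup-init _ k ⟩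
  lookup (π (suc j) le v) (inject₁ k)  ≡⟨ lookup-π le v _ ⟩
  lookup v (inject≤ (inject₁ k) le)    ≡⟨ cong (lookup v) (toℕ-injective (same-index k)) ⟩
  lookup v (inject≤ k le')             ≡⟨ lookup-π le' v k ⟨
  lookup (π j le' v) k                 ∎
  where
  same-index : ∀ k → toℕ (inject≤ (inject₁ k) le) ≡ toℕ (inject≤ k le')
  same-index k =
    trans (toℕ-inject≤ _ le) (trans (toℕ-inject₁ k) (sym (toℕ-inject≤ k le')))

π≡0v⇒lookup≡0 : (le : j ≤ n) (v : ZVec n) → π j le v ≡ 0v →
  ∀ k → toℕ k < j → lookup v k ≡ 0ℤ
π≡0v⇒lookup≡0 {j = j} le v πv≡0 k k<j = begin
  lookup v k               ≡⟨ cong (lookup v) (toℕ-injective same-index) ⟨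
  lookup v (inject≤ k' le) ≡⟨ lookup-π le v k' ⟨
  lookup (π j le v) k'     ≡⟨ cong (λ w → lookup w k') πv≡0 ⟩
  lookup 0v k'             ≡⟨ lookup-0v k' ⟩
  0ℤ                       ∎
  where
  k' = fromℕ< k<j
  same-index : toℕ (inject≤ k' le) ≡ toℕ k
  same-index = trans (toℕ-inject≤ k' le) (toℕ-fromℕ< k<j)

ℕComb-++ : (l l' : List (ℕ × ZVec m)) → ℕComb (l ++ l') ≡ ℕComb l +v ℕComb l'
ℕComb-++ []            l' = sym (+v-identityˡ (ℕComb l'))
ℕComb-++ ((c , v) ∷ l) l' =
  trans (cong (((+ c) ·v v) +v_) (ℕComb-++ l l')) (sym (+v-assoc ((+ c) ·v v) _ _))

InMonoidSpan-+v : {F : ZSet m} {u v : ZVec m} →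
  InMonoidSpan F u → InMonoidSpan F v → InMonoidSpan F (u +v v)
InMonoidSpan-+v (l , Fl , refl) (l' , Fl' , refl) = l ++ l' , ++⁺ Fl Fl' , ℕComb-++ l l'

lookup-zComb-∷ : (c : ℤ) (d : Vec ℤ s) (q : ZVec n) (p : Vec (ZVec n) s) (k : Fin n) →
  lookup (zComb (c ∷ d) (q ∷ p)) k ≡ c * lookup q k + lookup (zComb d p) k
lookup-zComb-∷ c d q p k = trans (lookup-+v (c ·v q) _ k) (cong (_+ _) (lookup-·v c q k))

lookup-zComb-+v : (c d : Vec ℤ s) (p : Vec (ZVec n) s) (k : Fin n) →
  lookup (zComb (c +v d) p) k ≡ lookup (zComb c p) k + lookup (zComb d p) k
lookup-zComb-+v []      []      []      k =
  trans (lookup-0v k) (sym (cong₂ _+_ (lookup-0v k) (lookup-0v k)))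
lookup-zComb-+v (x ∷ c) (y ∷ d) (q ∷ p) k = begin
  lookup (zComb (x + y ∷ c +v d) (q ∷ p)) k
    ≡⟨ lookup-zComb-∷ (x + y) (c +v d) q p k ⟩
  (x + y) * lookup q k + lookup (zComb (c +v d) p) k
    ≡⟨ cong (_+_ ((x + y) * lookup q k)) (lookup-zComb-+v c d p k) ⟩
  (x + y) * lookup q k + (lookup (zComb c p) k + lookup (zComb d p) k)
    ≡⟨ interchange x y (lookup q k) _ _ ⟩
  (x * lookup q k + lookup (zComb c p) k) + (y * lookup q k + lookup (zComb d p) k)
    ≡⟨ cong₂ _+_ (lookup-zComb-∷ x c q p k) (lookup-zComb-∷ y d q p k) ⟨
  lookup (zComb (x ∷ c) (q ∷ p)) k + lookup (zComb (y ∷ d) (q ∷ p)) k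
    ∎
  where
  interchange : ∀ x y q a b → (x + y) * q + (a + b) ≡ (x * q + a) + (y * q + b)
  interchange = solve-∀

lookup-zComb-·v : (a : ℤ) (c : Vec ℤ s) (p : Vec (ZVec n) s) (k : Fin n) →
  lookup (zComb (a ·v c) p) k ≡ a * lookup (zComb c p) k
lookup-zComb-·v a []      []      k =
  trans (lookup-0v k) (sym (trans (cong (a *_) (lookup-0v k)) (ℤₚ.*-zeroʳ a)))
lookup-zComb-·v a (x ∷ c) (q ∷ p) k = begin
  lookup (zComb (a * x ∷ a ·v c) (q ∷ p)) k
    ≡⟨ lookup-zComb-∷ (a * x) (a ·v c) q p k ⟩
  a * x * lookup q k + lookup (zComb (a ·v c) p) k
    ≡⟨ cong (_+_ (a * x * lookup q k)) (lookup-zComb-·v a c p k) ⟩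
  a * x * lookup q k + a * lookup (zComb c p) k
    ≡⟨ distrib a x (lookup q k) _ ⟩
  a * (x * lookup q k + lookup (zComb c p) k)
    ≡⟨ cong (a *_) (lookup-zComb-∷ x c q p k) ⟨
  a * lookup (zComb (x ∷ c) (q ∷ p)) k
    ∎
  where
  distrib : ∀ a x q b → a * x * q + a * b ≡ a * (x * q + b)
  distrib = solve-∀

lookup-zComb-≡0 : (d : Vec ℤ s) (p : Vec (ZVec n) s) (k : Fin n) →
  (∀ i → lookup d i * lookup (lookup p i) k ≡ 0ℤ) → lookup (zComb d p) k ≡ 0ℤ
lookup-zComb-≡0 []      []      k _      = lookup-0v k
lookup-zComb-≡0 (x ∷ d) (q ∷ p) k vanish = begin
  lookup (zComb (x ∷ d) (q ∷ p)) k
    ≡⟨ lookup-zComb-∷ x d q p k ⟩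
  x * lookup q k + lookup (zComb d p) k
    ≡⟨ cong₂ _+_ (vanish zero) (lookup-zComb-≡0 d p k (vanish ∘ suc)) ⟩
  0ℤ
    ∎

lookup-zComb-single : (d : Vec ℤ s) (p : Vec (ZVec n) s) (k : Fin n) (i₀ : Fin s) →
  (∀ i → i ≢ i₀ → lookup d i * lookup (lookup p i) k ≡ 0ℤ) →
  lookup (zComb d p) k ≡ lookup d i₀ * lookup (lookup p i₀) k
lookup-zComb-single (x ∷ d) (q ∷ p) k zero vanish = begin
  lookup (zComb (x ∷ d) (q ∷ p)) k
    ≡⟨ lookup-zComb-∷ x d q p k ⟩
  x * lookup q k + lookup (zComb d p) k
    ≡⟨ cong (_+_ (x * lookup q k)) (lookup-zComb-≡0 d p k (λ i → vanish (suc i) λ ())) ⟩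
  x * lookup q k + 0ℤ
    ≡⟨ ℤₚ.+-identityʳ _ ⟩
  x * lookup q k
    ∎
lookup-zComb-single (x ∷ d) (q ∷ p) k (suc i₀) vanish = begin
  lookup (zComb (x ∷ d) (q ∷ p)) k
    ≡⟨ lookup-zComb-∷ x d q p k ⟩
  x * lookup q k + lookup (zComb d p) k
    ≡⟨ cong₂ _+_ (vanish zero λ ()) (lookup-zComb-single d p k i₀ vanish-tail) ⟩
  0ℤ + lookup d i₀ * lookup (lookup p i₀) k
    ≡⟨ ℤₚ.+-identityˡ _ ⟩
  lookup d i₀ * lookup (lookup p i₀) k
    ∎
  where
  vanish-tail : ∀ i → i ≢ i₀ → lookup d i * lookup (lookup p i) k ≡ 0ℤ
  vanish-tail i i≢i₀ = vanish (suc i) (i≢i₀ ∘ suc-injective)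

zComb-≡0v : (d : Vec ℤ s) (p : Vec (ZVec n) s) → (∀ i → lookup d i ≡ 0ℤ) →
  zComb d p ≡ 0v
zComb-≡0v d p d≡0 = ≡-by-lookup λ k → trans
  (lookup-zComb-≡0 d p k (λ i → cong (_* lookup (lookup p i) k) (d≡0 i)))
  (sym (lookup-0v k))

Λ-0v : (p : Vec (ZVec n) s) → Λ p 0v
Λ-0v p = replicate _ 0ℤ , zComb-≡0v (replicate _ 0ℤ) p (λ i → lookup-replicate i 0ℤ)

Λ-+v : {p : Vec (ZVec n) s} {u v : ZVec n} → Λ p u → Λ p v → Λ p (u +v v)
Λ-+v {p = p} (c , refl) (d , refl) =
  c +v d , ≡-by-lookup λ k →
    trans (lookup-zComb-+v c d p k) (sym (lookup-+v (zComb c p) _ k))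

Λ-·v : {p : Vec (ZVec n) s} {v : ZVec n} (a : ℤ) → Λ p v → Λ p (a ·v v)
Λ-·v {p = p} a (c , refl) =
  a ·v c , ≡-by-lookup λ k →
    trans (lookup-zComb-·v a c p k) (sym (lookup-·v a (zComb c p) k))

i*j≡0∧0<j⇒i≡0 : ∀ i {j} → i * j ≡ 0ℤ → 0ℤ ℤ.< j → i ≡ 0ℤ
i*j≡0∧0<j⇒i≡0 i ij≡0 0<j with ℤₚ.i*j≡0⇒i≡0∨j≡0 i ij≡0
... | inj₁ i≡0 = i≡0
... | inj₂ j≡0 = ⊥-elim (ℤₚ.<⇒≢ 0<j (sym j≡0))

lookup-zComb-triangular : {p : Vec (ZVec n) s} → Echelon p →
  (d : Vec ℤ s) (i₀ : Fin s) → (∀ i → toℕ i < toℕ i₀ → lookup d i ≡ 0ℤ) →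
  ∀ k → toℕ k ≤ toℕ i₀ → lookup (zComb d p) k ≡ lookup d i₀ * lookup (lookup p i₀) k
lookup-zComb-triangular {p = p} (below , _) d i₀ d≡0 k k≤i₀ =
  lookup-zComb-single d p k i₀ vanish
  where
  vanish : ∀ i → i ≢ i₀ → lookup d i * lookup (lookup p i) k ≡ 0ℤ
  vanish i i≢i₀ with ℕₚ.<-cmp (toℕ i) (toℕ i₀)
  ... | tri< i<i₀ _ _ = cong (_* lookup (lookup p i) k) (d≡0 i i<i₀)
  ... | tri≈ _ i≡i₀ _ = ⊥-elim (i≢i₀ (toℕ-injective i≡i₀))
  ... | tri> _ _ i₀<i =
    trans (cong (lookup d i *_) (below i k (ℕₚ.≤-<-trans k≤i₀ i₀<i)))
          (ℤₚ.*-zeroʳ (lookup d i))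

coefficients-vanish : {p : Vec (ZVec n) s} → s ≤ n → Echelon p →
  ∀ j (d : Vec ℤ s) → (∀ k → toℕ k < j → lookup (zComb d p) k ≡ 0ℤ) →
  ∀ i → toℕ i < j → lookup d i ≡ 0ℤ
coefficients-vanish s≤n ech 0 d v≡0 i ()
coefficients-vanish {p = p} s≤n ech@(_ , diagonal>0) (suc j) d v≡0 i i<1+j =
  [ d≡0-below-j i , pivot-coefficient≡0 ]′ (ℕₚ.m<1+n⇒m<n∨m≡n i<1+j)
  where
  d≡0-below-j : ∀ i' → toℕ i' < j → lookup d i' ≡ 0ℤ
  d≡0-below-j = coefficients-vanish s≤n ech j d (λ k k<j → v≡0 k (ℕₚ.m<n⇒m<1+n k<j))
  k = inject≤ i s≤n
  k≡i : toℕ k ≡ toℕ i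
  k≡i = toℕ-inject≤ i s≤n
  pivot-coefficient≡0 : toℕ i ≡ j → lookup d i ≡ 0ℤ
  pivot-coefficient≡0 i≡j = i*j≡0∧0<j⇒i≡0 (lookup d i) dᵢpᵢ≡0 (diagonal>0 i k k≡i)
    where
    d≡0-below-i : ∀ i' → toℕ i' < toℕ i → lookup d i' ≡ 0ℤ
    d≡0-below-i i' i'<i = d≡0-below-j i' (subst (toℕ i' <_) i≡j i'<i)
    dᵢpᵢ≡0 : lookup d i * lookup (lookup p i) k ≡ 0ℤ
    dᵢpᵢ≡0 = begin
      lookup d i * lookup (lookup p i) k
        ≡⟨ lookup-zComb-triangular ech d i d≡0-below-i k (ℕₚ.≤-reflexive k≡i) ⟨
      lookup (zComb d p) k
        ≡⟨ v≡0 k (subst (_< suc j) (sym k≡i) i<1+j) ⟩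
      0ℤ
        ∎

-- ℤ · π_{j+1}(p_{j+1}) in the paper's 1-based indexing, and {0} when j ≥ s.
PivotLine : Vec (ZVec n) s → ∀ j → suc j ≤ n → ZSet (suc j)
PivotLine {s = s} p j le r =
  r ≡ 0v ⊎ Σ (j < s) λ j<s → Σ ℤ λ t → r ≡ t ·v π (suc j) le (lookup p (fromℕ< j<s))

π-zComb-pivot : {p : Vec (ZVec n) s} → Echelon p → (le : suc j ≤ n) (j<s : j < s) →
  (d : Vec ℤ s) → (∀ i → toℕ i < j → lookup d i ≡ 0ℤ) →
  π (suc j) le (zComb d p) ≡ lookup d (fromℕ< j<s) ·v π (suc j) le (lookup p (fromℕ< j<s))
π-zComb-pivot {j = j} {p = p} ech le j<s d d≡0 = ≡-by-lookup λ k → begin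
  lookup (π (suc j) le (zComb d p)) k
    ≡⟨ lookup-π le (zComb d p) k ⟩
  lookup (zComb d p) (inject≤ k le)
    ≡⟨ lookup-zComb-triangular ech d i₀ d≡0-below-i₀ _ (k≤i₀ k) ⟩
  lookup d i₀ * lookup (lookup p i₀) (inject≤ k le)
    ≡⟨ cong (lookup d i₀ *_) (lookup-π le (lookup p i₀) k) ⟨
  lookup d i₀ * lookup (π (suc j) le (lookup p i₀)) k
    ≡⟨ lookup-·v (lookup d i₀) (π (suc j) le (lookup p i₀)) k ⟨
  lookup (lookup d i₀ ·v π (suc j) le (lookup p i₀)) k
    ∎
  where
  i₀ = fromℕ< j<s
  i₀≡j : toℕ i₀ ≡ j
  i₀≡j = toℕ-fromℕ< j<s
  d≡0-below-i₀ : ∀ i → toℕ i < toℕ i₀ → lookup d i ≡ 0ℤ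
  d≡0-below-i₀ i i<i₀ = d≡0 i (subst (toℕ i <_) i₀≡j i<i₀)
  k≤i₀ : (k : Fin (suc j)) → toℕ (inject≤ k le) ≤ toℕ i₀
  k≤i₀ k = subst₂ _≤_ (sym (toℕ-inject≤ k le)) (sym i₀≡j) (s≤s⁻¹ (toℕ<n k))

π-kernel⊆PivotLine : {p : Vec (ZVec n) s} → s ≤ n → Echelon p →
  (le : suc j ≤ n) (le' : j ≤ n) →
  ∀ {v} → Λ p v → π j le' v ≡ 0v → PivotLine p j le (π (suc j) le v)
π-kernel⊆PivotLine {s = s} {j = j} {p = p} s≤n ech le le' (d , refl) πv≡0 =
  pivotLine (j <? s)
  where
  d≡0-below-j : ∀ i → toℕ i < j → lookup d i ≡ 0ℤ
  d≡0-below-j = coefficients-vanish s≤n ech j d (π≡0v⇒lookup≡0 le' (zComb d p) πv≡0)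
  pivotLine : Dec (j < s) → PivotLine p j le (π (suc j) le (zComb d p))
  pivotLine (yes j<s) =
    inj₂ (j<s , lookup d (fromℕ< j<s) , π-zComb-pivot ech le j<s d d≡0-below-j)
  pivotLine (no j≮s)  = inj₁ (trans (cong (π (suc j) le) (zComb-≡0v d p d≡0)) (π-0v le))
    where
    d≡0 : ∀ i → lookup d i ≡ 0ℤ
    d≡0 i = d≡0-below-j i (ℕₚ.<-≤-trans (toℕ<n i) (ℕₚ.≮⇒≥ j≮s))

π-fibre : {p : Vec (ZVec n) s} → s ≤ n → Echelon p →
  (le : suc j ≤ n) (le' : j ≤ n) →
  ∀ {u v} → Λ p u → Λ p v → π j le' u ≡ π j le' v →
  Σ (ZVec (suc j)) λ r → PivotLine p j le r × π (suc j) le v ≡ π (suc j) le u +v r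
π-fibre {n = n} {j = j} s≤n ech le le' {u} {v} Λu Λv πu≡πv =
  π (suc j) le w ,
  π-kernel⊆PivotLine s≤n ech le le' (Λ-+v Λv (Λ-·v -1ℤ Λu)) πw≡0 ,
  πv≡πu+πw
  where
  w = v +v (-1ℤ ·v u)
  π-w : ∀ {i} (i≤n : i ≤ n) → π i i≤n w ≡ π i i≤n v +v (-1ℤ ·v π i i≤n u)
  π-w i≤n = trans (π-+v i≤n v (-1ℤ ·v u)) (cong (π _ i≤n v +v_) (π-·v i≤n -1ℤ u))
  πw≡0 : π j le' w ≡ 0v
  πw≡0 = begin
    π j le' w                            ≡⟨ π-w le' ⟩
    π j le' v +v (-1ℤ ·v π j le' u)      ≡⟨ cong (_+v (-1ℤ ·v π j le' u)) πu≡πv ⟨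
    π j le' u +v (-1ℤ ·v π j le' u)      ≡⟨ +v-inverseʳ (π j le' u) ⟩
    0v                                   ∎
  πv≡πu+πw : π (suc j) le v ≡ π (suc j) le u +v π (suc j) le w
  πv≡πu+πw = sym (trans (cong (π (suc j) le u +v_) (π-w le))
                        (+v-cancel (π (suc j) le u) (π (suc j) le v)))

InMonoidSpan-lift : {a b : ℕ} (p : Vec (ZVec n) s) (la : a ≤ n) (lb : b ≤ n)
  {H : ZSet a} {F : ZSet b} →
  (∀ h → H h → Σ (ZVec n) λ u → Λ p u × π a la u ≡ h × F (π b lb u)) →
  ∀ {w} → InMonoidSpan H w →
  Σ (ZVec n) λ u → Λ p u × π a la u ≡ w × InMonoidSpan F (π b lb u)
InMonoidSpan-lift {n = n} {a = a} {b = b} p la lb {H} {F} lift (l , Hl , refl) = lift-list l Hl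
  where
  π-step : ∀ {i} (i≤n : i ≤ n) c (u v : ZVec n) →
    π i i≤n (((+ c) ·v u) +v v) ≡ ((+ c) ·v π i i≤n u) +v π i i≤n v
  π-step i≤n c u v =
    trans (π-+v i≤n ((+ c) ·v u) v) (cong (_+v π _ i≤n v) (π-·v i≤n (+ c) u))
  lift-list : ∀ l → All (λ cv → H (proj₂ cv)) l →
    Σ (ZVec n) λ u → Λ p u × π a la u ≡ ℕComb l × InMonoidSpan F (π b lb u)
  lift-list []            []        = 0v , Λ-0v p , π-0v la , [] , [] , sym (π-0v lb)
  lift-list ((c , h) ∷ l) (Hh ∷ Hl) with lift h Hh | lift-list l Hl
  ... | uₕ , Λuₕ , πuₕ≡h , Fπuₕ | uₗ , Λuₗ , πuₗ≡l , l' , Fl' , l'≡πuₗ =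
    ((+ c) ·v uₕ) +v uₗ ,
    Λ-+v (Λ-·v (+ c) Λuₕ) Λuₗ ,
    trans (π-step la c uₕ uₗ) (cong₂ (λ x y → ((+ c) ·v x) +v y) πuₕ≡h πuₗ≡l) ,
    (c , π b lb uₕ) ∷ l' , Fπuₕ ∷ Fl' ,
    trans (cong (((+ c) ·v π b lb uₕ) +v_) l'≡πuₗ) (sym (π-step lb c uₕ uₗ))

Fset-lift : (p : Vec (ZVec n) s) (le : suc j ≤ n) (le' : j ≤ n) {H : ZSet j} →
  H ⊆ K p j le' →
  ∀ h → H h → Σ (ZVec n) λ u → Λ p u × π j le' u ≡ h × Fset p j le H (π (suc j) le u)
Fset-lift p le le' {H} H⊆K h Hh with H⊆K h Hh
... | u , Λu , refl =
  u , Λu , refl , inj₁ (subst H (sym (init-π le le' u)) Hh , u , Λu , refl)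

K⁺∪K⁻⊆K∩init≥0 : (p : Vec (ZVec n) s) (le : suc j ≤ n) →
  (K⁺ p (suc j) le ∪ K⁻ p j le) ⊆ λ z → K p (suc j) le z × NonNegAll (init z)
K⁺∪K⁻⊆K∩init≥0 _ _ _ (inj₁ (z∈K , z≥0))        = z∈K , All-init z≥0
K⁺∪K⁻⊆K∩init≥0 _ _ _ (inj₂ (z∈K , init≥0 , _)) = z∈K , init≥0

PivotLine⊆InMonoidSpan : (p : Vec (ZVec n) s) (le : suc j ≤ n) (H : ZSet j) →
  PivotLine p j le ⊆ InMonoidSpan (Fset p j le H)
PivotLine⊆InMonoidSpan _ _ _ _ (inj₁ refl) = [] , [] , refl
PivotLine⊆InMonoidSpan _ _ _ _ (inj₂ (j<s , + t , refl)) =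
  (t , _) ∷ [] , inj₂ (j<s , inj₁ refl) ∷ [] , +v-identityʳ _
PivotLine⊆InMonoidSpan _ _ _ _ (inj₂ (j<s , -[1+ t ] , refl)) =
  (suc t , _) ∷ [] , inj₂ (j<s , inj₂ refl) ∷ [] ,
  trans (+v-identityʳ _) (·v-neg (+ suc t) _)

lemma2p2 : (n s : ℕ) → 1 ≤ s → s ≤ n →
    (p : Vec (ZVec n) s) → Echelon p →
    (j : ℕ) → 1 ≤ j → (le : suc j ≤ n) →
    (H : ZSet j) → IsMinimalGenSet H (K⁺ p j (≤-trans (n≤1+n j) le)) →
    (K⁺ p (suc j) le ∪ K⁻ p j le) ⊆ InMonoidSpan (Fset p j le H)
lemma2p2 n s _ s≤n p ech j _ le H ((H⊆K⁺ , K⁺⊆span) , _) z z∈K⁺∪K⁻ =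
  let le' = ≤-trans (n≤1+n j) le
      ((v , Λv , πv≡z) , init≥0) = K⁺∪K⁻⊆K∩init≥0 p le z z∈K⁺∪K⁻
      πv∈K⁺ : K⁺ p j le' (π j le' v)
      πv∈K⁺ = (v , Λv , refl) ,
              subst NonNegAll (trans (cong init (sym πv≡z)) (init-π le le' v)) init≥0
      H⊆K = λ h Hh → proj₁ (H⊆K⁺ h Hh)
      (u , Λu , πu≡πv , πu∈span) =
        InMonoidSpan-lift p le' le (Fset-lift p le le' H⊆K) (K⁺⊆span _ πv∈K⁺)
      (r , r∈PivotLine , πv≡πu+r) = π-fibre s≤n ech le le' Λu Λv πu≡πv
  in subst (InMonoidSpan (Fset p j le H)) (trans (sym πv≡πu+r) πv≡z)
       (InMonoidSpan-+v πu∈span (PivotLine⊆InMonoidSpan p le H r r∈PivotLine))
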